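{- Let $S$ be a numerical set whose complement $\widetilde{S}$ is a numerical semigroup. Then $A(S)$ has at most one small atom. Moreover, if $S$ is not a numerical semigroup, then $A(S)$ has at most one small element.
   Context: $\mathbb{N}=\{0,1,2,\dots\}$. A numerical set is a subset $S\subseteq\mathbb{N}$ with $0\in S$ and $\mathbb{N}\setminus S$ finite. Its gaps are the elements of $\mathbb{N}\setminus S$, and $F(S)$ is the largest gap, with $F(\mathbb{N})=-1$. A numerical semigroup is a numerical set closed under addition. The associated semigroup of $S$ is $A(S)=\{s\in S\mid s+S\subseteq S\}$; it is a numerical semigroup with $F(A(S))=F(S)$. For a numerical semigroup $T$: - an atom is a positive element of $T$ not expressible as a sum of two positive elements of $T$; - a small atom is an atom smaller than $F(T)$; - a small element is a positive element of $T$ smaller than $F(T)$. For $S\neq\mathbb{N}$, the base is $B(S)=\max\{s\in S\mid s<F(S)\}$. Young diagram of $S$: it has one left-justified row for each gap $\ell$. The top row corresponds to $F(S)$, and the gaps decrease going down. The row for $\ell$ has length $|\{s\in S\mid s<\ell\}|$. This is a bijection between numerical sets and Young diagrams, with $\mathbb{N}$ corresponding to the empty diagram. The complement of a Young diagram with rows $\lambda_1\ge\dots\ge\lambda_g$ has rows $\lambda_1-\lambda_g\ge\dots\ge\lambda_1-\lambda_1$, zero rows being discarded. Geometrically, this is the rest of the $g\times\lambda_1$ rectangle rotated by $180^\circ$. The complement $\widetilde{S}$ is the numerical set whose Young diagram is the complement of that of $S$. One has $\widetilde{\mathbb{N}}=\mathbb{N}$, and for $S\neq\mathbb{N}$ equivalently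 $\widetilde{S}=\{B(S)-s\mid s\in S,\ s\le B(S)\}\cup\{n\mid n\ge B(S)\}$. -}

module Defs where

open import Data.Nat using (ℕ; _+_; _≤_; _<_)
open import Data.Bool using (Bool; true)
open import Data.Product using (Σ; ∃; ∃-syntax; _×_)
open import Data.Sum using (_⊎_)
open import Relation.Nullary using (¬_)
open import Relation.Binary.PropositionalEquality using (_≡_)

Pred : Set₁
Pred = ℕ → Set

_∈_ : ℕ → (ℕ → Bool) → Set
n ∈ S = S n ≡ true

mem : (ℕ → Bool) → Pred
mem S n = n ∈ S

IsNumericalSet : Pred → Set
IsNumericalSet P = P 0 × ∃[ N ] (∀ n → N ≤ n → P n)

ClosedUnderAddition : Pred → Set
ClosedUnderAddition P = ∀ m n → P m → P n → P (m + n)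

IsNumericalSemigroup : Pred → Set
IsNumericalSemigroup P = IsNumericalSet P × ClosedUnderAddition P

-- f is the Frobenius number F(P) (largest gap).  For P = ℕ there is no such f
-- (F(ℕ) = -1).
IsFrobenius : Pred → ℕ → Set
IsFrobenius P f = ¬ P f × (∀ n → f < n → P n)

IsBase : Pred → ℕ → Set
IsBase P b = Σ ℕ λ f → IsFrobenius P f × P b × b < f × (∀ s → P s → s < f → s ≤ b)

-- Complement S̃ of a numerical set:
--   S̃ = ℕ                                             if S = ℕ,
--   S̃ = { B(S) - s | s ∈ S, s ≤ B(S) } ∪ { n | n ≥ B(S) }  otherwise.
-- (n = B(S) - s with s ≤ B(S) is written as B(S) ≡ s + n.)
Complement : Pred → Pred
Complement P n =
  (∀ m → P m) ⊎
  (Σ ℕ λ b → IsBase P b × ((Σ ℕ λ s → P s × s ≤ b × b ≡ s + n) ⊎ b ≤ n))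

Assoc : Pred → Pred
Assoc P s = P s × (∀ t → P t → P (s + t))

IsAtom : Pred → ℕ → Set
IsAtom T a = T a × 0 < a ×
  ¬ (Σ ℕ λ x → Σ ℕ λ y → 0 < x × 0 < y × T x × T y × x + y ≡ a)

IsSmallAtom : Pred → ℕ → Set
IsSmallAtom T a = IsAtom T a × (Σ ℕ λ f → IsFrobenius T f × a < f)

IsSmallElement : Pred → ℕ → Set
IsSmallElement T a = T a × 0 < a × (Σ ℕ λ f → IsFrobenius T f × a < f)

-- Let b be the base of S, so that its complement is T = {b − s | s ∈ S, s ≤ b} ∪ [b, ∞).
-- If A(S) contains some a with 0 < a < b, then T ∩ [0, b] is stable under subtracting a,
-- and every x ∈ T below a satisfies F(S) < b + (a − x).  For m the least positive element
-- of T these two facts give m ∣ a, then m ∣ t for every t ∈ T ∩ [0, b], and F(S) < b + m.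
-- So S ∩ [0, b] consists of the multiples of m up to b: S is a semigroup whose only atom
-- up to b is m.  Two distinct small elements (or small atoms) of A(S) yield such an a
-- below the larger one.
module Submission where

open import Defs
open import Data.Bool using (Bool; true)
open import Data.Bool.Properties using () renaming (_≟_ to _≟ᵇ_)
open import Data.Nat using (ℕ; zero; suc; _+_; _*_; _∸_; _≤_; _<_; _/_; _%_; _≤?_; _<?_; NonZero; >-nonZero)
open import Data.Nat.Properties
open import Data.Nat.DivMod using (m≡m%n+[m/n]*n; m%n<n)
open import Data.Nat.Divisibility using (_∣_; divides; ∣-refl; ∣⇒≤; ∣m∣n⇒∣m+n; ∣m+n∣m⇒∣n; m%n≡0⇒n∣m)
open import Data.Nat.Induction using (<-rec)
open import Data.Product using (∃-syntax; _×_; _,_; proj₁; proj₂)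
open import Data.Sum using (_⊎_; inj₁; inj₂)
open import Relation.Nullary using (¬_; yes; no; contradiction)
open import Relation.Nullary.Decidable using (_×-dec_)
open import Relation.Unary using (Decidable)
open import Relation.Binary.Definitions using (tri<; tri≈; tri>)
open import Relation.Binary.PropositionalEquality using (_≡_; refl; sym; trans; cong; subst; module ≡-Reasoning)

at-most-one : {Q : Pred} → (∀ {x y} → Q x → Q y → x < y → x ≡ y) →
              ∀ x y → Q x → Q y → x ≡ y
at-most-one unique x y Qx Qy with <-cmp x y
... | tri< x<y _ _ = unique Qx Qy x<y
... | tri≈ _ x≡y _ = x≡y
... | tri> _ _ y<x = sym (unique Qy Qx y<x)

least-witness : {Q : Pred} → Decidable Q → ∀ {n} → Q n →
                ∃[ k ] Q k × (∀ {j} → j < k → ¬ Q j)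
least-witness {Q} Q? {n} = <-rec (λ n → Q n → ∃[ k ] Q k × (∀ {j} → j < k → ¬ Q j)) search n
  where
  search : ∀ n → (∀ {j} → j < n → Q j → ∃[ k ] Q k × (∀ {i} → i < k → ¬ Q i)) →
           Q n → ∃[ k ] Q k × (∀ {j} → j < k → ¬ Q j)
  search n below Qn with anyUpTo? Q? n
  ... | yes (j , j<n , Qj) = below j<n Qj
  ... | no none            = n , Qn , λ j<n Qj → none (_ , j<n , Qj)

multiple-above : ∀ {d m n} → d ∣ m → d ∣ n → m < n → m + d ≤ n
multiple-above {d} {m} {n} d∣m d∣n m<n = begin
  m + d        ≤⟨ +-monoʳ-≤ m (∣⇒≤ {{>-nonZero (m<n⇒0<n∸m m<n)}} d∣n∸m) ⟩
  m + (n ∸ m)  ≡⟨ m+[n∸m]≡n (<⇒≤ m<n) ⟩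
  n            ∎
  where
  open ≤-Reasoning
  d∣n∸m : d ∣ n ∸ m
  d∣n∸m = ∣m+n∣m⇒∣n (subst (d ∣_) (sym (m+[n∸m]≡n (<⇒≤ m<n))) d∣n) d∣m

IsFrobenius-unique : ∀ {P f g} → IsFrobenius P f → IsFrobenius P g → f ≡ g
IsFrobenius-unique {P} {f} {g} = at-most-one unique f g
  where
  unique : ∀ {f g} → IsFrobenius P f → IsFrobenius P g → f < g → f ≡ g
  unique (_ , above-f) (¬Pg , _) f<g = contradiction (above-f _ f<g) ¬Pg

IsBase-unique : ∀ {P b c} → IsBase P b → IsBase P c → b ≡ c
IsBase-unique (_ , frob , Pb , b<f , ≤b) (_ , frob′ , Pc , c<g , ≤c)
  with IsFrobenius-unique frob frob′
... | refl = ≤-antisym (≤c _ Pb b<f) (≤b _ Pc c<g)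

Assoc-Frobenius-≤ : ∀ {P f g} → IsFrobenius P f → IsFrobenius (Assoc P) g → g ≤ f
Assoc-Frobenius-≤ {g = g} (_ , above-f) (g∉A , _) = ≮⇒≥ λ f<g →
  g∉A (above-f g f<g , λ t _ → above-f (g + t) (<-≤-trans f<g (m≤m+n g t)))

-- The complement of P with its base fixed to b; the conjunct s ≤ b of Complement is
-- implied by b ≡ s + n and is dropped.
ComplementAt : Pred → ℕ → Pred
ComplementAt P b n = (∃[ s ] P s × b ≡ s + n) ⊎ b ≤ n

Complement⇒ComplementAt : ∀ {P b n} → IsBase P b → Complement P n → ComplementAt P b n
Complement⇒ComplementAt (f , (¬Pf , _) , _) (inj₁ all) = contradiction (all f) ¬Pf
Complement⇒ComplementAt base (inj₂ (c , base′ , n∈T)) with IsBase-unique base′ base | n∈T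
... | refl | inj₁ (s , Ps , _ , c≡s+n) = inj₁ (s , Ps , c≡s+n)
... | refl | inj₂ c≤n                 = inj₂ c≤n

ComplementAt⇒Complement : ∀ {P b n} → IsBase P b → ComplementAt P b n → Complement P n
ComplementAt⇒Complement {n = n} base (inj₁ (s , Ps , b≡s+n)) =
  inj₂ (_ , base , inj₁ (s , Ps , subst (s ≤_) (sym b≡s+n) (m≤m+n s n) , b≡s+n))
ComplementAt⇒Complement base (inj₂ b≤n) = inj₂ (_ , base , inj₂ b≤n)

ComplementAt-closed : ∀ {P b} → IsBase P b → ClosedUnderAddition (Complement P) →
                      ClosedUnderAddition (ComplementAt P b)
ComplementAt-closed base closed m n Tm Tn = Complement⇒ComplementAt base
  (closed m n (ComplementAt⇒Complement base Tm) (ComplementAt⇒Complement base Tn))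

below-Assoc-Frobenius⇒≤base : ∀ {P g y} → Complement P 0 → IsFrobenius (Assoc P) g →
                               P y → y < g → ∃[ b ] IsBase P b × y ≤ b
below-Assoc-Frobenius⇒≤base {g = g} (inj₁ all) (g∉A , _) _ _ =
  contradiction (all g , λ t _ → all (g + t)) g∉A
below-Assoc-Frobenius⇒≤base (inj₂ (b , base@(_ , frob , _ , _ , ≤b) , _)) frobA Py y<g =
  b , base , ≤b _ Py (<-≤-trans y<g (Assoc-Frobenius-≤ frob frobA))

module WithClosedComplement {P : Pred} (P? : Decidable P) (P0 : P 0)
         {f b : ℕ} (frob : IsFrobenius P f) (Pb : P b)
         (below-f⇒≤b : ∀ s → P s → s < f → s ≤ b)
         (T-closed : ClosedUnderAddition (ComplementAt P b))
  where

  T : Pred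
  T = ComplementAt P b

  above-base⇒above-Frobenius : ∀ {s} → P s → b < s → f < s
  above-base⇒above-Frobenius {s} Ps b<s with <-cmp f s
  ... | tri< f<s _ _ = f<s
  ... | tri≈ _ refl _ = contradiction Ps (proj₁ frob)
  ... | tri> _ _ s<f = contradiction (below-f⇒≤b s Ps s<f) (<⇒≱ b<s)

  T-0 : T 0
  T-0 = inj₁ (b , Pb , sym (+-identityʳ b))

  T? : Decidable T
  T? n with b ≤? n
  ... | yes b≤n = yes (inj₂ b≤n)
  ... | no b≰n with P? (b ∸ n)
  ...   | yes P[b∸n] = yes (inj₁ (b ∸ n , P[b∸n] , sym (m∸n+n≡m (≰⇒≥ b≰n))))
  ...   | no ¬P[b∸n] = no λ
    { (inj₁ (s , Ps , b≡s+n)) → ¬P[b∸n] (subst P (sym (b∸n≡ b≡s+n)) Ps)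
    ; (inj₂ b≤n)              → b≰n b≤n }
    where
    b∸n≡ : ∀ {s} → b ≡ s + n → b ∸ n ≡ s
    b∸n≡ {s} b≡s+n = trans (cong (_∸ n) b≡s+n) (m+n∸n≡m s n)

  T-mirror⇒P : ∀ {s} → s ≤ b → T (b ∸ s) → P s
  T-mirror⇒P {s} s≤b (inj₁ (s′ , Ps′ , b≡s′+u)) =
    subst P (+-cancelʳ-≡ (b ∸ s) s′ s (trans (sym b≡s′+u) (sym (m+[n∸m]≡n s≤b)))) Ps′
  T-mirror⇒P {s} s≤b (inj₂ b≤b∸s) = subst P (sym s≡0) P0
    where
    s≡0 : s ≡ 0
    s≡0 = n≤0⇒n≡0 (+-cancelʳ-≤ (b ∸ s) s 0
            (≤-trans (≤-reflexive (m+[n∸m]≡n s≤b)) b≤b∸s))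

  P⇒T-mirror : ∀ {s} → P s → s ≤ b → T (b ∸ s)
  P⇒T-mirror Ps s≤b = inj₁ (_ , Ps , sym (m+[n∸m]≡n s≤b))

  module WithAssocElement {a : ℕ} (a∈A : Assoc P a) (0<a : 0 < a) (a<b : a < b) where

    T-sub : ∀ {u} → T (a + u) → a + u ≤ b → T u
    T-sub {u} (inj₁ (s , Ps , b≡s+[a+u])) _ = inj₁ (a + s , proj₂ a∈A s Ps , b≡[a+s]+u)
      where
      open ≡-Reasoning
      b≡[a+s]+u : b ≡ a + s + u
      b≡[a+s]+u = begin
        b            ≡⟨ b≡s+[a+u] ⟩
        s + (a + u)  ≡⟨ sym (+-assoc s a u) ⟩
        s + a + u    ≡⟨ cong (_+ u) (+-comm s a) ⟩
        a + s + u    ∎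
    T-sub (inj₂ b≤a+u) a+u≤b = inj₁ (_ , proj₁ a∈A , ≤-antisym b≤a+u a+u≤b)

    -- The mirror image b − x of x ∈ T below a is an s ∈ S with a + s > b, hence a + s > F(S).
    T-below-a⇒f<d+b : ∀ {x d} → T x → x + d ≡ a → 0 < d → f < d + b
    T-below-a⇒f<d+b {x} {d} (inj₁ (s , Ps , b≡s+x)) x+d≡a 0<d =
      subst (f <_) a+s≡d+b (above-base⇒above-Frobenius (proj₂ a∈A s Ps) b<a+s)
      where
      open ≡-Reasoning
      a+s≡d+b : a + s ≡ d + b
      a+s≡d+b = begin
        a + s        ≡⟨ cong (_+ s) (sym x+d≡a) ⟩
        x + d + s    ≡⟨ +-comm (x + d) s ⟩
        s + (x + d)  ≡⟨ sym (+-assoc s x d) ⟩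
        s + x + d    ≡⟨ cong (_+ d) (sym b≡s+x) ⟩
        b + d        ≡⟨ +-comm b d ⟩
        d + b        ∎
      b<a+s : b < a + s
      b<a+s = subst (b <_) (sym a+s≡d+b) (m<n+m b 0<d)
    T-below-a⇒f<d+b {x} {d} (inj₂ b≤x) x+d≡a _ =
      contradiction (≤-trans b≤x (subst (x ≤_) x+d≡a (m≤m+n x d))) (<⇒≱ a<b)

    least-positive : ∃[ m ] (0 < m × T m) × (∀ {j} → j < m → ¬ (0 < j × T j))
    least-positive = least-witness (λ n → (0 <? n) ×-dec T? n) (<-trans 0<a a<b , inj₂ ≤-refl)

    m : ℕ
    m = proj₁ least-positive

    0<m : 0 < m
    0<m = proj₁ (proj₁ (proj₂ least-positive))

    T-m : T m
    T-m = proj₂ (proj₁ (proj₂ least-positive))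

    instance
      m-nonZero : NonZero m
      m-nonZero = >-nonZero 0<m

    m≤T-positive : ∀ {y} → T y → 0 < y → m ≤ y
    m≤T-positive Ty 0<y = ≮⇒≥ λ y<m → proj₂ (proj₂ least-positive) y<m (0<y , Ty)

    T-multiple : ∀ k → T (k * m)
    T-multiple zero    = T-0
    T-multiple (suc k) = T-closed m (k * m) T-m (T-multiple k)

    a+m≤b : a + m ≤ b
    a+m≤b = subst (a + m ≤_) a+v≡b (+-monoʳ-≤ a (m≤T-positive Tv (m<n⇒0<n∸m a<b)))
      where
      a+v≡b : a + (b ∸ a) ≡ b
      a+v≡b = m+[n∸m]≡n (<⇒≤ a<b)
      Tv : T (b ∸ a)
      Tv = T-sub (subst T (sym a+v≡b) (inj₂ ≤-refl)) (≤-reflexive a+v≡b)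

    T-below-a⇒+m≤a : ∀ {y} → T y → y < a → y + m ≤ a
    T-below-a⇒+m≤a {y} Ty y<a = ≮⇒≥ no-overshoot
      where
      no-overshoot : ¬ (a < y + m)
      no-overshoot a<y+m =
        <⇒≱ (+-cancelˡ-< a u m a+u<a+m) (m≤T-positive Tu (m<n⇒0<n∸m a<y+m))
        where
        u : ℕ
        u = y + m ∸ a
        a+u≡y+m : a + u ≡ y + m
        a+u≡y+m = m+[n∸m]≡n (<⇒≤ a<y+m)
        a+u<a+m : a + u < a + m
        a+u<a+m = subst (_< a + m) (sym a+u≡y+m) (+-monoˡ-< m y<a)
        Tu : T u
        Tu = T-sub (subst T (sym a+u≡y+m) (T-closed y m Ty T-m))
                   (≤-trans (<⇒≤ a+u<a+m) a+m≤b)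

    m∣distance-to-a : ∀ {y} d → T y → y + d ≡ a → m ∣ d
    m∣distance-to-a {y} d Ty y+d≡a = m%n≡0⇒n∣m d m (n≤0⇒n≡0 (≮⇒≥ remainder-not-positive))
      where
      z : ℕ
      z = y + (d / m) * m
      z+r≡a : z + d % m ≡ a
      z+r≡a = begin
        y + (d / m) * m + d % m    ≡⟨ +-assoc y _ _ ⟩
        y + ((d / m) * m + d % m)  ≡⟨ cong (y +_) (+-comm _ (d % m)) ⟩
        y + (d % m + (d / m) * m)  ≡⟨ cong (y +_) (sym (m≡m%n+[m/n]*n d m)) ⟩
        y + d                      ≡⟨ y+d≡a ⟩
        a                          ∎
        where open ≡-Reasoning
      remainder-not-positive : ¬ (0 < d % m)
      remainder-not-positive 0<r = <⇒≱ (m%n<n d m) (+-cancelˡ-≤ z m (d % m) z+m≤z+r)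
        where
        z<a : z < a
        z<a = subst (z <_) z+r≡a (m<m+n z 0<r)
        z+m≤z+r : z + m ≤ z + d % m
        z+m≤z+r = subst (z + m ≤_) (sym z+r≡a)
                    (T-below-a⇒+m≤a (T-closed y _ Ty (T-multiple (d / m))) z<a)

    m∣a : m ∣ a
    m∣a = m∣distance-to-a a T-0 refl

    m∣T-upto-a : ∀ {y} → T y → y ≤ a → m ∣ y
    m∣T-upto-a {y} Ty y≤a = ∣m+n∣m⇒∣n (subst (m ∣_) (sym (m∸n+n≡m y≤a)) m∣a)
                                       (m∣distance-to-a (a ∸ y) Ty (m+[n∸m]≡n y≤a))

    m∣T-upto-b : ∀ {y} → T y → y ≤ b → m ∣ y
    m∣T-upto-b {y} = <-rec (λ y → T y → y ≤ b → m ∣ y) reduce y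
      where
      reduce : ∀ y → (∀ {u} → u < y → T u → u ≤ b → m ∣ u) → T y → y ≤ b → m ∣ y
      reduce y smaller Ty y≤b with a ≤? y
      ... | no a≰y  = m∣T-upto-a Ty (<⇒≤ (≰⇒> a≰y))
      ... | yes a≤y = subst (m ∣_) a+u≡y
                        (∣m∣n⇒∣m+n m∣a (smaller u<y Tu (≤-trans (m∸n≤m y a) y≤b)))
        where
        a+u≡y : a + (y ∸ a) ≡ y
        a+u≡y = m+[n∸m]≡n a≤y
        Tu : T (y ∸ a)
        Tu = T-sub (subst T (sym a+u≡y) Ty) (subst (_≤ b) (sym a+u≡y) y≤b)
        u<y : y ∸ a < y
        u<y = subst (y ∸ a <_) a+u≡y (m<n+m (y ∸ a) 0<a)

    m∣b : m ∣ b
    m∣b = m∣T-upto-b (inj₂ ≤-refl) ≤-refl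

    Frobenius<b+m : f < b + m
    Frobenius<b+m with m∣a
    ... | divides zero    a≡0     = contradiction (sym a≡0) (<⇒≢ 0<a)
    ... | divides (suc k) a≡m+km  = subst (f <_) (+-comm m b)
          (T-below-a⇒f<d+b (T-multiple k) (trans (+-comm (k * m) m) (sym a≡m+km)) 0<m)

    P⇒m∣ : ∀ {s} → P s → s ≤ b → m ∣ s
    P⇒m∣ {s} Ps s≤b = ∣m+n∣m⇒∣n (subst (m ∣_) (sym (m∸n+n≡m s≤b)) m∣b)
                                 (m∣T-upto-b (P⇒T-mirror Ps s≤b) (m∸n≤m b s))

    m∣⇒P-upto-b : ∀ {s} → m ∣ s → s ≤ b → P s
    m∣⇒P-upto-b {s} m∣s s≤b with ∣m+n∣m⇒∣n (subst (m ∣_) (sym (m+[n∸m]≡n s≤b)) m∣b) m∣s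
    ... | divides q b∸s≡qm = T-mirror⇒P s≤b (subst T (sym b∸s≡qm) (T-multiple q))

    m∣⇒P : ∀ {n} → m ∣ n → P n
    m∣⇒P {n} m∣n with n ≤? b
    ... | yes n≤b = m∣⇒P-upto-b m∣n n≤b
    ... | no n≰b  = proj₂ frob n (<-≤-trans Frobenius<b+m (multiple-above m∣b m∣n (≰⇒> n≰b)))

    P-closed : ClosedUnderAddition P
    P-closed x y Px Py with x ≤? b | y ≤? b
    ... | no x≰b | _ = proj₂ frob (x + y)
          (<-≤-trans (above-base⇒above-Frobenius Px (≰⇒> x≰b)) (m≤m+n x y))
    ... | _ | no y≰b = proj₂ frob (x + y)
          (<-≤-trans (above-base⇒above-Frobenius Py (≰⇒> y≰b)) (m≤n+m y x))
    ... | yes x≤b | yes y≤b = m∣⇒P (∣m∣n⇒∣m+n (P⇒m∣ Px x≤b) (P⇒m∣ Py y≤b))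

    m∣⇒Assoc : ∀ {n} → m ∣ n → Assoc P n
    m∣⇒Assoc m∣n = m∣⇒P m∣n , λ t → P-closed _ t (m∣⇒P m∣n)

    Assoc-atom≡m : ∀ {c} → IsAtom (Assoc P) c → c ≤ b → c ≡ m
    Assoc-atom≡m {c} ((Pc , _) , 0<c , irreducible) c≤b = ≤-antisym (≮⇒≥ m≮c) m≤c
      where
      m∣c : m ∣ c
      m∣c = P⇒m∣ Pc c≤b
      m≤c : m ≤ c
      m≤c = ∣⇒≤ {{>-nonZero 0<c}} m∣c
      m≮c : ¬ (m < c)
      m≮c m<c = irreducible
        (m , c ∸ m , 0<m , m<n⇒0<n∸m m<c , m∣⇒Assoc ∣-refl , m∣⇒Assoc m∣c∸m ,
         m+[n∸m]≡n m≤c)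
        where
        m∣c∸m : m ∣ c ∸ m
        m∣c∸m = ∣m+n∣m⇒∣n (subst (m ∣_) (sym (m+[n∸m]≡n m≤c)) m∣c) ∣-refl

small-Assoc-structure : ∀ {P x y g} → Decidable P → P 0 →
  Complement P 0 → ClosedUnderAddition (Complement P) →
  Assoc P x → 0 < x → x < y → P y → IsFrobenius (Assoc P) g → y < g →
  ClosedUnderAddition P ×
  (∀ {c d} → IsAtom (Assoc P) c → IsAtom (Assoc P) d → c ≤ y → d ≤ y → c ≡ d)
small-Assoc-structure P? P0 T0 closed x∈A 0<x x<y Py frobA y<g
  with below-Assoc-Frobenius⇒≤base T0 frobA Py y<g
... | _ , base@(_ , frob , Pb , _ , ≤b) , y≤b =
  P-closed , λ c-atom d-atom c≤y d≤y →
    trans (Assoc-atom≡m c-atom (≤-trans c≤y y≤b)) (sym (Assoc-atom≡m d-atom (≤-trans d≤y y≤b)))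
  where
  open WithClosedComplement P? P0 frob Pb ≤b (ComplementAt-closed base closed)
  open WithAssocElement x∈A 0<x (<-≤-trans x<y y≤b)

small-atoms-<⇒≡ : ∀ {P x y} → Decidable P → P 0 →
  Complement P 0 → ClosedUnderAddition (Complement P) →
  IsSmallAtom (Assoc P) x → IsSmallAtom (Assoc P) y → x < y → x ≡ y
small-atoms-<⇒≡ P? P0 T0 closed
  (x-atom@(x∈A , 0<x , _) , _) (y-atom@((Py , _) , _) , _ , frobA , y<g) x<y
  = proj₂ (small-Assoc-structure P? P0 T0 closed x∈A 0<x x<y Py frobA y<g)
      x-atom y-atom (<⇒≤ x<y) ≤-refl

small-elements-<⇒closed : ∀ {P x y} → Decidable P → P 0 →
  Complement P 0 → ClosedUnderAddition (Complement P) →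
  IsSmallElement (Assoc P) x → IsSmallElement (Assoc P) y → x < y → ClosedUnderAddition P
small-elements-<⇒closed P? P0 T0 closed
  (x∈A , 0<x , _) ((Py , _) , _ , _ , frobA , y<g) x<y =
  proj₁ (small-Assoc-structure P? P0 T0 closed x∈A 0<x x<y Py frobA y<g)

theorem4p1 : (S : ℕ → Bool) → IsNumericalSet (mem S) →
    IsNumericalSemigroup (Complement (mem S)) →
    (∀ a b → IsSmallAtom (Assoc (mem S)) a → IsSmallAtom (Assoc (mem S)) b → a ≡ b)
    × (¬ IsNumericalSemigroup (mem S) →
       ∀ a b → IsSmallElement (Assoc (mem S)) a → IsSmallElement (Assoc (mem S)) b → a ≡ b)
theorem4p1 S S-numerical@(S0 , _) ((T0 , _) , T-closed) =
  at-most-one (small-atoms-<⇒≡ S? S0 T0 T-closed) ,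
  λ ¬semigroup → at-most-one λ x y x<y →
    contradiction (S-numerical , small-elements-<⇒closed S? S0 T0 T-closed x y x<y) ¬semigroup
  where
  S? : Decidable (mem S)
  S? n = S n ≟ᵇ true
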